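{- Let $\Gamma$ be a graph with girth $g \geq 4$. Then $\Gamma$ admits a partial orientation as a quasi-transitive mixed graph if and only if $\Gamma$ has no odd cycle.
   Context: A mixed graph has a vertex set, a set of (undirected) edges and a set of arcs, with at most one edge or arc between any pair of vertices. A partial orientation of a graph $\Gamma$ is a mixed graph obtained from $\Gamma$ by orienting some of its edges as arcs. A $2$-dipath is a directed path $uvw$ consisting of arcs $u\to v$, $v\to w$; it is induced if $u$ and $w$ are not joined by an edge or arc. A mixed graph $H$ is quasi-transitive when (1) it has no induced $2$-dipath and (2) for every edge $uv$ of $H$ there is a vertex $w$ such that $uwv$ or $vwu$ is a $2$-dipath. -}

module Defs where

open import Data.Nat using (ℕ; zero; suc; _*_; _≤_)
open import Data.Fin using (Fin; toℕ)
open import Data.Bool using (Bool; T)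
open import Data.Product using (Σ; ∃; _×_)
open import Data.Sum using (_⊎_)
open import Relation.Nullary using (¬_)
open import Relation.Binary.PropositionalEquality using (_≡_)
open import Function.Definitions using (Injective)

record Graph (n : ℕ) : Set where
  field
    adj     : Fin n → Fin n → Bool
    sym     : ∀ u v → T (adj u v) → T (adj v u)
    irrefl  : ∀ u → ¬ T (adj u u)

  Adj : Fin n → Fin n → Set
  Adj u v = T (adj u v)

open Graph public

record Cycle {n : ℕ} (Γ : Graph n) (k : ℕ) : Set where
  field
    vtx      : Fin k → Fin n
    len≥3    : 3 ≤ k
    distinct : Injective _≡_ _≡_ vtx
    consec   : ∀ (i j : Fin k) →
               (suc (toℕ i) ≡ toℕ j ⊎ (suc (toℕ i) ≡ k × toℕ j ≡ 0)) →
               Adj Γ (vtx i) (vtx j)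

Odd : ℕ → Set
Odd k = Σ ℕ λ m → k ≡ suc (2 * m)

-- girth g ≥ 4: every cycle has length at least 4 (vacuous for forests,
-- whose girth is ∞).
GirthAtLeast4 : {n : ℕ} → Graph n → Set
GirthAtLeast4 Γ = ∀ k → Cycle Γ k → 4 ≤ k

HasOddCycle : {n : ℕ} → Graph n → Set
HasOddCycle Γ = Σ ℕ λ k → Cycle Γ k × Odd k

-- Edges of the resulting mixed graph
-- are the edges of Γ oriented in neither direction; u and w are joined by
-- an edge or arc iff they are adjacent in Γ.
record PartialOrientation {n : ℕ} (Γ : Graph n) : Set where
  field
    arc       : Fin n → Fin n → Bool
    arc⊆edge  : ∀ u v → T (arc u v) → Adj Γ u v
    antisym   : ∀ u v → T (arc u v) → ¬ T (arc v u)

  Arc : Fin n → Fin n → Set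
  Arc u v = T (arc u v)

  Joined : Fin n → Fin n → Set
  Joined u v = Adj Γ u v

  UEdge : Fin n → Fin n → Set
  UEdge u v = Adj Γ u v × ¬ Arc u v × ¬ Arc v u

  DiPath2 : Fin n → Fin n → Fin n → Set
  DiPath2 u v w = Arc u v × Arc v w

  InducedDiPath2 : Fin n → Fin n → Fin n → Set
  InducedDiPath2 u v w = DiPath2 u v w × ¬ Joined u w

  QuasiTransitive : Set
  QuasiTransitive =
    (∀ u v w → ¬ InducedDiPath2 u v w) ×
    (∀ u v → UEdge u v → ∃ λ w → DiPath2 u w v ⊎ DiPath2 v w u)

open PartialOrientation public

HasQTPartialOrientation : {n : ℕ} → Graph n → Set
HasQTPartialOrientation Γ = Σ (PartialOrientation Γ) QuasiTransitive

-- Girth ≥ 4 means that Γ has no triangles. In a triangle-free mixed graph every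
-- 2-dipath is induced, and an undirected edge uv can never lie under the 2-dipath
-- u → w → v that quasi-transitivity demands. So a quasi-transitive partial
-- orientation orients every edge and has no 2-dipath at all: every vertex is a
-- source or a sink, which is a proper 2-colouring, and Γ has no odd cycle.
-- Conversely, an odd closed walk contains an odd cycle (cut it at a repeated
-- vertex and keep the odd half), so without odd cycles Γ is bipartite, and
-- orienting every edge from one colour class to the other is quasi-transitive.
-- Bipartiteness of a finite graph is decidable, so the colouring may be built
-- classically: colour a vertex by whether the least vertex of its component
-- reaches it by a walk of even length.
module Submission where

open import Defs hiding (sym)
open import Data.Bool as Bool using (Bool; true; false; not; _∧_; T)
open import Data.Bool.Properties using (¬-not; not-¬; not-involutive; T-∧; T-≡)
open import Data.Empty using (⊥; ⊥-elim)
open import Data.Fin as Fin using (Fin; toℕ; fromℕ<; inject)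
open import Data.Fin.Properties
  using (toℕ-injective; toℕ-fromℕ<; toℕ-inject; toℕ<n; any?; all?; ∀-cons; ¬∀⟶∃¬-smallest; <-cmp)
  renaming (_≟_ to _≟ᶠ_; _<?_ to _<ᶠ?_)
open import Data.Nat using (ℕ; zero; suc; _+_; _*_; _≤_; _<_; z≤n; s≤s; z<s; NonZero; >-nonZero; parity)
open import Data.Fin.Subset.Properties using (anySubset?)
open import Data.Vec using (lookup; tabulate)
open import Data.Vec.Properties using (lookup∘tabulate)
open import Data.Nat.DivMod using (_mod_; m<n⇒m%n≡m; n%n≡0)
open import Data.Nat.Induction using (<-wellFounded)
open import Data.Nat.Properties
  using (+-suc; +-identityʳ; *-suc; ≤-refl; ≤-reflexive; ≤-trans; <⇒≤; ≮⇒≥; n≤0⇒n≡0; m≤m+n; m<m+n; m<n+m;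
         +-monoˡ-<; +-monoʳ-<; <-≤-trans; ≤-antisym; <-irrefl; ≤⇒≯; +-comm; m≤n⇒∃[o]m+o≡n)
  renaming (_<?_ to _<ℕ?_)
open import Data.Nat.Tactic.RingSolver using (solve-∀)
open import Data.Parity.Base as ℙ using (0ℙ; 1ℙ; _⁻¹)
open import Data.Parity.Properties using (+-homo-+)
open import Data.Product using (Σ; ∃; ∃₂; _×_; _,_; proj₁; proj₂)
open import Data.Sum using (_⊎_; inj₁; inj₂)
open import Function using (_∘_)
open import Function.Bundles using (_⇔_; mk⇔; Equivalence)
open import Function.Definitions using (Injective)
open import Induction.WellFounded using (Acc; acc)
open import Relation.Binary.Definitions using (tri<; tri≈; tri>)
open import Relation.Binary.PropositionalEquality using (_≡_; _≢_; refl; sym; trans; cong; subst; module ≡-Reasoning)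
open import Relation.Nullary using (¬_; Dec; yes; no)
open import Relation.Nullary.Decidable using (_×-dec_; _→-dec_; does; T?; ¬?; decidable-stable; ¬¬-excluded-middle; map′)

parity-suc : ∀ m → parity (suc m) ≡ parity m ⁻¹
parity-suc m = +-homo-+ 1 m

odd-+ : ∀ a b → parity (a + b) ≡ 1ℙ → parity a ≡ 1ℙ ⊎ parity b ≡ 1ℙ
odd-+ a b odd = split (parity a) (parity b) (trans (sym (+-homo-+ a b)) odd)
  where
  split : ∀ p q → p ℙ.+ q ≡ 1ℙ → p ≡ 1ℙ ⊎ q ≡ 1ℙ
  split 1ℙ q _ = inj₁ refl
  split 0ℙ q q≡1ℙ = inj₂ q≡1ℙ

parity≡1ℙ⇒Odd : ∀ {L} → parity L ≡ 1ℙ → Odd L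
parity≡1ℙ⇒Odd {zero} ()
parity≡1ℙ⇒Odd {1} _ = 0 , refl
parity≡1ℙ⇒Odd {suc (suc L)} odd with parity≡1ℙ⇒Odd {L} odd
... | m , refl = suc m , cong suc (sym (*-suc 2 m))

parity≡1ℙ⇒3≤ : ∀ {L} → parity L ≡ 1ℙ → L ≢ 1 → 3 ≤ L
parity≡1ℙ⇒3≤ {zero} ()
parity≡1ℙ⇒3≤ {1} _ L≢1 = ⊥-elim (L≢1 refl)
parity≡1ℙ⇒3≤ {2} ()
parity≡1ℙ⇒3≤ {suc (suc (suc L))} _ _ = s≤s (s≤s (s≤s z≤n))

¬¬-∀-Fin : ∀ {m} {P : Fin m → Set} → (∀ i → ¬ ¬ P i) → ¬ ¬ (∀ i → P i)
¬¬-∀-Fin {zero}  _  ¬∀ = ¬∀ λ ()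
¬¬-∀-Fin {suc m} ¬¬P ¬∀ = ¬¬P Fin.zero λ P₀ → ¬¬-∀-Fin (¬¬P ∘ Fin.suc) λ P₊ → ¬∀ (∀-cons P₀ P₊)

¬¬-decidable₂ : ∀ {m k} (P : Fin m → Fin k → Set) → ¬ ¬ (∀ x y → Dec (P x y))
¬¬-decidable₂ P = ¬¬-∀-Fin λ x → ¬¬-∀-Fin λ y → ¬¬-excluded-middle

module _ {n : ℕ} (Γ : Graph n) where

  -- Positions are natural numbers so that closed walks can be cut and spliced by
  -- arithmetic on positions; only vertex 0, …, vertex L matter.
  record ClosedWalk (L : ℕ) : Set where
    field
      vertex : ℕ → Fin n
      step   : ∀ i → i < L → Adj Γ (vertex i) (vertex (suc i))
      closed : vertex L ≡ vertex 0

  open ClosedWalk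

  cycle⇒closedWalk : ∀ {k} → Cycle Γ k → ClosedWalk k
  cycle⇒closedWalk {k} C = record
    { vertex = λ m → vtx (m mod k)
    ; step   = step′
    ; closed = cong vtx (toℕ-injective (trans toℕ-mod-self (sym (toℕ-mod-< 0<k))))
    }
    where
    open Cycle C
    0<k : 0 < k
    0<k = ≤-trans (s≤s z≤n) len≥3

    instance
      k≢0 : NonZero k
      k≢0 = >-nonZero 0<k

    toℕ-mod-< : ∀ {m} → m < k → toℕ (m mod k) ≡ m
    toℕ-mod-< m<k = trans (toℕ-fromℕ< _) (m<n⇒m%n≡m m<k)

    toℕ-mod-self : toℕ (k mod k) ≡ 0
    toℕ-mod-self = trans (toℕ-fromℕ< _) (n%n≡0 k)

    step′ : ∀ i → i < k → Adj Γ (vtx (i mod k)) (vtx (suc i mod k))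
    step′ i i<k with suc i <ℕ? k
    ... | yes 1+i<k = consec _ _ (inj₁ (trans (cong suc (toℕ-mod-< i<k)) (sym (toℕ-mod-< 1+i<k))))
    ... | no 1+i≮k  = consec _ _ (inj₂ (trans (cong suc (toℕ-mod-< i<k)) 1+i≡k ,
                                        subst (λ m → toℕ (m mod k) ≡ 0) (sym 1+i≡k) toℕ-mod-self))
      where
      1+i≡k : suc i ≡ k
      1+i≡k = ≤-antisym i<k (≮⇒≥ 1+i≮k)

  module _ {L} (w : ClosedWalk L) {i ℓ r : ℕ} (L≡ : L ≡ i + ℓ + r)
           (repeat : vertex w i ≡ vertex w (i + ℓ)) where

    private
      i+ℓ≤L : i + ℓ ≤ L
      i+ℓ≤L = ≤-trans (m≤m+n (i + ℓ) r) (≤-reflexive (sym L≡))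

      i+r+ℓ≡L : i + r + ℓ ≡ L
      i+r+ℓ≡L = trans (arith i ℓ r) (sym L≡)
        where
        arith : ∀ i ℓ r → i + r + ℓ ≡ i + ℓ + r
        arith = solve-∀

    loop : ClosedWalk ℓ
    loop = record
      { vertex = λ k → vertex w (i + k)
      ; step   = λ k k<ℓ → subst (Adj Γ (vertex w (i + k)) ∘ vertex w) (sym (+-suc i k))
                             (step w (i + k) (<-≤-trans (+-monoʳ-< i k<ℓ) i+ℓ≤L))
      ; closed = trans (sym repeat) (cong (vertex w) (sym (+-identityʳ i)))
      }

    private
      skipLoop : ℕ → ℕ
      skipLoop k with k <ℕ? i
      ... | yes _ = k
      ... | no  _ = k + ℓ

      k<L : ∀ {k} → k < i → k < L
      k<L k<i = <-≤-trans k<i (≤-trans (m≤m+n i ℓ) i+ℓ≤L)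

      skipLoop-step : ∀ k → k < i + r → Adj Γ (vertex w (skipLoop k)) (vertex w (skipLoop (suc k)))
      skipLoop-step k k<i+r with k <ℕ? i | suc k <ℕ? i
      ... | yes k<i | yes _    = step w k (k<L k<i)
      ... | yes k<i | no 1+k≮i =
        subst (Adj Γ (vertex w k)) (trans (cong (vertex w) 1+k≡i) repeat′) (step w k (k<L k<i))
        where
        1+k≡i : suc k ≡ i
        1+k≡i = ≤-antisym k<i (≮⇒≥ 1+k≮i)
        repeat′ : vertex w i ≡ vertex w (suc k + ℓ)
        repeat′ = trans repeat (cong (λ m → vertex w (m + ℓ)) (sym 1+k≡i))
      ... | no k≮i  | yes 1+k<i = ⊥-elim (k≮i (<⇒≤ 1+k<i))
      ... | no _    | no _      = step w (k + ℓ) (<-≤-trans (+-monoˡ-< ℓ k<i+r) (≤-reflexive i+r+ℓ≡L))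

      skipLoop-end : skipLoop (i + r) ≡ L
      skipLoop-end with i + r <ℕ? i
      ... | yes i+r<i = ⊥-elim (<-irrefl refl (<-≤-trans i+r<i (m≤m+n i r)))
      ... | no _      = i+r+ℓ≡L

      skipLoop-start : vertex w (skipLoop 0) ≡ vertex w 0
      skipLoop-start with 0 <ℕ? i
      ... | yes _  = refl
      ... | no 0≮i = subst (λ j → vertex w (j + ℓ) ≡ vertex w j) (n≤0⇒n≡0 (≮⇒≥ 0≮i)) (sym repeat)

    shortcut : ClosedWalk (i + r)
    shortcut = record
      { vertex = vertex w ∘ skipLoop
      ; step   = skipLoop-step
      ; closed = trans (cong (vertex w) skipLoop-end) (trans (closed w) (sym skipLoop-start))
      }

  -- The length bound is what lets a triangle contradict girth ≥ 4.
  OddCycle≤ : ℕ → Set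
  OddCycle≤ L = Σ ℕ λ k → k ≤ L × Cycle Γ k × Odd k

  OddCycle≤-mono : ∀ {m L} → m ≤ L → OddCycle≤ m → OddCycle≤ L
  OddCycle≤-mono m≤L (k , k≤m , C , odd) = k , ≤-trans k≤m m≤L , C , odd

  injective⇒cycle : ∀ {L} (w : ClosedWalk L) → parity L ≡ 1ℙ →
                    Injective _≡_ _≡_ (vertex w ∘ toℕ) → Cycle Γ L
  injective⇒cycle {L} w odd inj = record
    { vtx      = vertex w ∘ toℕ
    ; len≥3    = parity≡1ℙ⇒3≤ odd L≢1
    ; distinct = inj
    ; consec   = consec
    }
    where
    L≢1 : L ≢ 1
    L≢1 L≡1 = irrefl Γ (vertex w 0)
      (subst (Adj Γ (vertex w 0)) (trans (cong (vertex w) (sym L≡1)) (closed w))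
        (step w 0 (subst (0 <_) (sym L≡1) z<s)))

    consec : ∀ (i j : Fin L) → suc (toℕ i) ≡ toℕ j ⊎ (suc (toℕ i) ≡ L × toℕ j ≡ 0) →
             Adj Γ (vertex w (toℕ i)) (vertex w (toℕ j))
    consec i j (inj₁ next) = subst (Adj Γ _ ∘ vertex w) next (step w (toℕ i) (toℕ<n i))
    consec i j (inj₂ (last , first)) =
      subst (Adj Γ _) (trans (cong (vertex w) last) (trans (closed w) (cong (vertex w) (sym first))))
        (step w (toℕ i) (toℕ<n i))

  Repetition : ∀ {L} → ClosedWalk L → Set
  Repetition {L} w = ∃₂ λ (i j : Fin L) → i Fin.< j × vertex w (toℕ i) ≡ vertex w (toℕ j)

  repetition? : ∀ {L} (w : ClosedWalk L) → Dec (Repetition w)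
  repetition? w = any? λ i → any? λ j → (i <ᶠ? j) ×-dec (vertex w (toℕ i) ≟ᶠ vertex w (toℕ j))

  no-repetition⇒injective : ∀ {L} (w : ClosedWalk L) → ¬ Repetition w → Injective _≡_ _≡_ (vertex w ∘ toℕ)
  no-repetition⇒injective w ¬rep {x} {y} eq with <-cmp x y
  ... | tri< x<y _ _ = ⊥-elim (¬rep (x , y , x<y , eq))
  ... | tri≈ _ x≡y _ = x≡y
  ... | tri> _ _ y<x = ⊥-elim (¬rep (y , x , y<x , sym eq))

  repetition⇒split : ∀ {L} (w : ClosedWalk L) → Repetition w →
                     Σ ℕ λ i → Σ ℕ λ d → Σ ℕ λ e →
                       L ≡ i + suc d + suc e × vertex w i ≡ vertex w (i + suc d)
  repetition⇒split {L} w (i , j , i<j , repeat) with m≤n⇒∃[o]m+o≡n i<j | m≤n⇒∃[o]m+o≡n (toℕ<n j)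
  ... | d , i+1+d≡j | e , j+1+e≡L = toℕ i , d , e , L≡ , trans repeat (cong (vertex w) j≡)
    where
    j≡ : toℕ j ≡ toℕ i + suc d
    j≡ = trans (sym i+1+d≡j) (sym (+-suc (toℕ i) d))

    L≡ : L ≡ toℕ i + suc d + suc e
    L≡ = trans (sym j+1+e≡L) (trans (sym (+-suc (toℕ j) e)) (cong (_+ suc e) j≡))

  repetition⇒shorter : ∀ {L} (w : ClosedWalk L) → parity L ≡ 1ℙ → Repetition w →
                       Σ ℕ λ m → m < L × ClosedWalk m × parity m ≡ 1ℙ
  repetition⇒shorter {L} w odd rep with repetition⇒split w rep
  ... | i , d , e , L≡ , repeat = pick (odd-+ (suc d) (i + suc e) (subst (λ m → parity m ≡ 1ℙ) L≡′ odd))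
    where
    arith : ∀ i d e → i + suc d + suc e ≡ suc d + (i + suc e)
    arith = solve-∀

    L≡′ : L ≡ suc d + (i + suc e)
    L≡′ = trans L≡ (arith i d e)

    pick : parity (suc d) ≡ 1ℙ ⊎ parity (i + suc e) ≡ 1ℙ →
           Σ ℕ λ m → m < L × ClosedWalk m × parity m ≡ 1ℙ
    pick (inj₁ loop-odd) =
      suc d , subst (suc d <_) (sym L≡′) (m<m+n (suc d) (subst (0 <_) (sym (+-suc i e)) z<s)) ,
      loop w L≡ repeat , loop-odd
    pick (inj₂ rest-odd) =
      i + suc e , subst (i + suc e <_) (sym L≡′) (m<n+m (i + suc e) {suc d} z<s) ,
      shortcut w L≡ repeat , rest-odd

  oddClosedWalk⇒oddCycle : ∀ {L} → ClosedWalk L → parity L ≡ 1ℙ → OddCycle≤ L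
  oddClosedWalk⇒oddCycle w = shorten (<-wellFounded _) w
    where
    shorten : ∀ {L} → Acc _<_ L → ClosedWalk L → parity L ≡ 1ℙ → OddCycle≤ L
    shorten {L} (acc rec) w odd with repetition? w
    ... | no ¬rep = L , ≤-refl , injective⇒cycle w odd (no-repetition⇒injective w ¬rep) , parity≡1ℙ⇒Odd odd
    ... | yes rep with repetition⇒shorter w odd rep
    ...   | m , m<L , w′ , odd′ = OddCycle≤-mono (<⇒≤ m<L) (shorten (rec m<L) w′ odd′)

  infixr 5 _∷_ _++_
  data Walk : Fin n → Fin n → ℕ → Set where
    []  : ∀ {u} → Walk u u 0
    _∷_ : ∀ {u v w L} → Adj Γ u v → Walk v w L → Walk u w (suc L)

  _++_ : ∀ {u v w a b} → Walk u v a → Walk v w b → Walk u w (a + b)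
  []      ++ q = q
  (e ∷ p) ++ q = e ∷ (p ++ q)

  reverse : ∀ {u v L} → Walk u v L → Walk v u L
  reverse []                = []
  reverse (_∷_ {L = L} e p) = subst (Walk _ _) (+-comm L 1) (reverse p ++ Graph.sym Γ _ _ e ∷ [])

  vertexAt : ∀ {u v L} → Walk u v L → ℕ → Fin n
  vertexAt {u} []      _       = u
  vertexAt {u} (e ∷ p) zero    = u
  vertexAt     (e ∷ p) (suc i) = vertexAt p i

  vertexAt-start : ∀ {u v L} (p : Walk u v L) → vertexAt p 0 ≡ u
  vertexAt-start []      = refl
  vertexAt-start (e ∷ p) = refl

  vertexAt-end : ∀ {u v L} (p : Walk u v L) → vertexAt p L ≡ v
  vertexAt-end []      = refl
  vertexAt-end (e ∷ p) = vertexAt-end p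

  vertexAt-step : ∀ {u v L} (p : Walk u v L) i → i < L → Adj Γ (vertexAt p i) (vertexAt p (suc i))
  vertexAt-step (_∷_ {u} e p) zero    _         = subst (Adj Γ u) (sym (vertexAt-start p)) e
  vertexAt-step (e ∷ p)       (suc i) (s≤s i<L) = vertexAt-step p i i<L

  toClosedWalk : ∀ {u L} → Walk u u L → ClosedWalk L
  toClosedWalk p = record
    { vertex = vertexAt p
    ; step   = vertexAt-step p
    ; closed = trans (vertexAt-end p) (sym (vertexAt-start p))
    }

  girth≥4⇒triangle-free : GirthAtLeast4 Γ → ∀ {a b c} → Adj Γ a b → Adj Γ b c → Adj Γ c a → ⊥
  girth≥4⇒triangle-free girth ab bc ca
    with oddClosedWalk⇒oddCycle (toClosedWalk (ab ∷ bc ∷ ca ∷ [])) refl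
  ... | k , k≤3 , C , _ = ≤⇒≯ k≤3 (girth k C)

  NoOddClosedWalk : Set
  NoOddClosedWalk = ∀ {u L} → Walk u u L → parity L ≢ 1ℙ

  noOddCycle⇒noOddClosedWalk : ¬ HasOddCycle Γ → NoOddClosedWalk
  noOddCycle⇒noOddClosedWalk noOddCycle p odd with oddClosedWalk⇒oddCycle (toClosedWalk p) odd
  ... | k , _ , C , k-odd = noOddCycle (k , C , k-odd)

  ProperColouring : (Fin n → Bool) → Set
  ProperColouring c = ∀ u v → Adj Γ u v → c u ≢ c v

  Bipartite : Set
  Bipartite = Σ (Fin n → Bool) ProperColouring

  proper⇒noOddClosedWalk : ∀ {c} → ProperColouring c → ∀ {L} → ClosedWalk L → ¬ Odd L
  proper⇒noOddClosedWalk {c} proper {L} w (m , refl) =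
    not-¬ refl (begin
      c (vertex w 0)               ≡⟨ cong c (closed w) ⟨
      c (vertex w (suc (2 * m)))   ≡⟨ flip (2 * m) ≤-refl ⟩
      not (c (vertex w (2 * m)))   ≡⟨ cong not (even-steps m ≤-refl) ⟩
      not (c (vertex w 0))         ∎)
    where
    open ≡-Reasoning

    flip : ∀ j → j < L → c (vertex w (suc j)) ≡ not (c (vertex w j))
    flip j j<L = ¬-not λ eq → proper _ _ (step w j j<L) (sym eq)

    even-steps : ∀ m → 2 * m < L → c (vertex w (2 * m)) ≡ c (vertex w 0)
    even-steps zero    _       = refl
    even-steps (suc m) 2[m+1]<L = begin
      c (vertex w (2 * suc m))           ≡⟨ cong (c ∘ vertex w) (*-suc 2 m) ⟩
      c (vertex w (suc (suc (2 * m))))   ≡⟨ flip (suc (2 * m)) 2m+1<L ⟩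
      not (c (vertex w (suc (2 * m))))   ≡⟨ cong not (flip (2 * m) 2m<L) ⟩
      not (not (c (vertex w (2 * m))))   ≡⟨ not-involutive _ ⟩
      c (vertex w (2 * m))               ≡⟨ even-steps m 2m<L ⟩
      c (vertex w 0)                     ∎
      where
      2m+1<L : suc (2 * m) < L
      2m+1<L = <⇒≤ (subst (_< L) (*-suc 2 m) 2[m+1]<L)
      2m<L : 2 * m < L
      2m<L = <⇒≤ 2m+1<L

  module _ (girth : GirthAtLeast4 Γ) (O : PartialOrientation Γ) (qt : QuasiTransitive O) where

    qt⇒no-2-dipath : ∀ {u v w} → Arc O u v → Arc O v w → ⊥
    qt⇒no-2-dipath {u} {v} {w} uv vw with T? (adj Γ u w)
    ... | yes uw =
      girth≥4⇒triangle-free girth (arc⊆edge O u v uv) (arc⊆edge O v w vw) (Graph.sym Γ u w uw)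
    ... | no ¬uw = proj₁ qt u v w ((uv , vw) , ¬uw)

    qt⇒oriented : ∀ {u v} → Adj Γ u v → Arc O u v ⊎ Arc O v u
    qt⇒oriented {u} {v} e with T? (arc O u v) | T? (arc O v u)
    ... | yes uv | _      = inj₁ uv
    ... | no _   | yes vu = inj₂ vu
    ... | no ¬uv | no ¬vu with proj₂ qt u v (e , ¬uv , ¬vu)
    ...   | w , inj₁ (uw , wv) =
      ⊥-elim (girth≥4⇒triangle-free girth (arc⊆edge O u w uw) (arc⊆edge O w v wv) (Graph.sym Γ u v e))
    ...   | w , inj₂ (vw , wu) =
      ⊥-elim (girth≥4⇒triangle-free girth (arc⊆edge O v w vw) (arc⊆edge O w u wu) e)

    isTail : Fin n → Bool
    isTail v = does (any? λ w → T? (arc O v w))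

    isTail-source : ∀ {u v} → Arc O u v → isTail u ≡ true
    isTail-source {u} {v} uv with any? (λ w → T? (arc O u w))
    ... | yes _   = refl
    ... | no ¬arc = ⊥-elim (¬arc (v , uv))

    isTail-target : ∀ {u v} → Arc O u v → isTail v ≡ false
    isTail-target {u} {v} uv with any? (λ w → T? (arc O v w))
    ... | yes (w , vw) = ⊥-elim (qt⇒no-2-dipath uv vw)
    ... | no _         = refl

    qt⇒bipartite : Bipartite
    qt⇒bipartite = isTail , proper
      where
      proper : ProperColouring isTail
      proper u v e with qt⇒oriented e
      ... | inj₁ uv rewrite isTail-source uv | isTail-target uv = λ ()
      ... | inj₂ vu rewrite isTail-source vu | isTail-target vu = λ ()

  bipartite⇒qt : Bipartite → HasQTPartialOrientation Γ
  bipartite⇒qt (c , proper) = O , no-2-dipath , no-undirected-edge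
    where
    tail-colour : ∀ {u v} → T (c u ∧ adj Γ u v) → c u ≡ true
    tail-colour uv = Equivalence.to T-≡ (proj₁ (Equivalence.to T-∧ uv))

    O : PartialOrientation Γ
    O = record
      { arc      = λ u v → c u ∧ adj Γ u v
      ; arc⊆edge = λ _ _ uv → proj₂ (Equivalence.to T-∧ uv)
      ; antisym  = λ u v uv vu → proper u v (proj₂ (Equivalence.to T-∧ uv))
                                   (trans (tail-colour uv) (sym (tail-colour vu)))
      }

    no-2-dipath : ∀ u v w → ¬ InducedDiPath2 O u v w
    no-2-dipath u v w ((uv , vw) , _) =
      proper u v (arc⊆edge O u v uv) (trans (tail-colour uv) (sym (tail-colour vw)))

    no-undirected-edge : ∀ u v → UEdge O u v → ∃ λ w → DiPath2 O u w v ⊎ DiPath2 O v w u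
    no-undirected-edge u v (e , ¬uv , ¬vu) with c u in cu | c v in cv
    ... | true  | _     = ⊥-elim (¬uv e)
    ... | false | true  = ⊥-elim (¬vu (Graph.sym Γ u v e))
    ... | false | false = ⊥-elim (proper u v e (trans cu (sym cv)))

  Reach : Fin n → Fin n → Set
  Reach u v = ∃ λ L → Walk u v L

  EvenReach : Fin n → Fin n → Set
  EvenReach u v = ∃ λ L → Walk u v L × parity L ≡ 0ℙ

  reach-snoc : ∀ {r u v} → Reach r u → Adj Γ u v → Reach r v
  reach-snoc (L , p) e = L + 1 , p ++ e ∷ []

  module _ (noOdd : NoOddClosedWalk)
           (reach? : ∀ u v → Dec (Reach u v)) (evenReach? : ∀ u v → Dec (EvenReach u v)) where

    private
      leastReaching : ∀ v → ∃ λ r → ¬ ¬ Reach r v × ((j : Fin.Fin′ r) → ¬ Reach (inject j) v)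
      leastReaching v = ¬∀⟶∃¬-smallest n (λ r → ¬ Reach r v) (λ r → ¬? (reach? r v)) (λ ∀¬ → ∀¬ v (0 , []))

    root : Fin n → Fin n
    root v = proj₁ (leastReaching v)

    root-reaches : ∀ v → Reach (root v) v
    root-reaches v = decidable-stable (reach? _ v) (proj₁ (proj₂ (leastReaching v)))

    below-root : ∀ {r v} → r Fin.< root v → ¬ Reach r v
    below-root {r} {v} r<root =
      subst (λ j → ¬ Reach j v) (toℕ-injective (trans (toℕ-inject _) (toℕ-fromℕ< r<root)))
        (proj₂ (proj₂ (leastReaching v)) (fromℕ< r<root))

    root-cong : ∀ {u v} → Adj Γ u v → root u ≡ root v
    root-cong {u} {v} e with <-cmp (root u) (root v)
    ... | tri< ru<rv _ _ = ⊥-elim (below-root ru<rv (reach-snoc (root-reaches u) e))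
    ... | tri≈ _ ru≡rv _ = ru≡rv
    ... | tri> _ _ rv<ru = ⊥-elim (below-root rv<ru (reach-snoc (root-reaches v) (Graph.sym Γ u v e)))

    colour : Fin n → Bool
    colour v = does (evenReach? (root v) v)

    evenReach-differs : ∀ {r u v} → Reach r u → Adj Γ u v → does (evenReach? r u) ≢ does (evenReach? r v)
    evenReach-differs {r} {u} {v} (L , p) e with evenReach? r u | evenReach? r v
    ... | yes (L₁ , p₁ , even₁) | yes (L₂ , p₂ , even₂) = λ _ → noOdd (p₁ ++ e ∷ reverse p₂) odd
      where
      odd : parity (L₁ + suc L₂) ≡ 1ℙ
      odd rewrite +-homo-+ L₁ (suc L₂) | parity-suc L₂ | even₁ | even₂ = refl
    ... | yes _ | no _ = λ ()
    ... | no _  | yes _ = λ ()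
    ... | no ¬u | no ¬v with parity L in parity-L
    ...   | 0ℙ = λ _ → ¬u (L , p , parity-L)
    ...   | 1ℙ = λ _ → ¬v (L + 1 , p ++ e ∷ [] , trans (+-homo-+ L 1) (cong (ℙ._+ 1ℙ) parity-L))

    colour-proper : ProperColouring colour
    colour-proper u v e eq =
      evenReach-differs (root-reaches u) e (trans eq (cong (λ r → does (evenReach? r v)) (sym (root-cong e))))

  proper? : ∀ c → Dec (ProperColouring c)
  proper? c = all? λ u → all? λ v → T? (adj Γ u v) →-dec ¬? (c u Bool.≟ c v)

  bipartite? : Dec Bipartite
  bipartite? = map′ (λ (S , proper) → lookup S , proper) (λ (c , proper) → tabulate c , tabulate-proper proper)
                    (anySubset? (proper? ∘ lookup))
    where
    tabulate-proper : ∀ {c} → ProperColouring c → ProperColouring (lookup (tabulate c))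
    tabulate-proper {c} proper u v e eq =
      proper u v e (trans (sym (lookup∘tabulate c u)) (trans eq (lookup∘tabulate c v)))

  noOddClosedWalk⇒bipartite : NoOddClosedWalk → Bipartite
  noOddClosedWalk⇒bipartite noOdd with bipartite?
  ... | yes bipartite = bipartite
  ... | no ¬bipartite =
    ⊥-elim (¬¬-decidable₂ Reach λ reach? → ¬¬-decidable₂ EvenReach λ evenReach? →
              ¬bipartite (colour noOdd reach? evenReach? , colour-proper noOdd reach? evenReach?))

theorem2p3 : ∀ (n : ℕ) (Γ : Graph n) → GirthAtLeast4 Γ →
    (HasQTPartialOrientation Γ ⇔ (¬ HasOddCycle Γ))
theorem2p3 n Γ girth = mk⇔
  (λ (O , qt) (k , C , odd) →
    proper⇒noOddClosedWalk Γ (proj₂ (qt⇒bipartite Γ girth O qt)) (cycle⇒closedWalk Γ C) odd)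
  (λ noOddCycle → bipartite⇒qt Γ (noOddClosedWalk⇒bipartite Γ (noOddCycle⇒noOddClosedWalk Γ noOddCycle)))
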